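{- Let $n\ge1$, $\sigma\in\mathcal{M}(2n)$, and let $G(\sigma)=(V,E)$ be its crossing graph. For $\pi$ a set partition of $V$, let $i(E,\pi)$ be the number of edges in $E$ both of whose endpoints lie in the same block of $\pi$. Then \[ \sum_{\substack{\pi\in\mathcal{P}(2n)\\ \pi\ge\sigma}} q^{\mathrm{cro}(\sigma,\pi)}\mu(\pi,\hat 1) = \sum_{\pi\in\mathcal{P}(V)} q^{i(E,\pi)}\mu(\pi,\hat1). \]
   Context: $q$ is a formal variable. $\mathcal{P}(V)$ is the lattice of set partitions of a finite set $V$ (ordered by refinement), $\mathcal{P}(2n)=\mathcal{P}(\{1,\dots,2n\})$, $\hat1$ is its maximal element (the one-block partition) and $\mu$ its Möbius function. $\mathcal{M}(2n)\subset\mathcal{P}(2n)$ is the set of matchings (all blocks, called arches, of size 2). For $\sigma\le\pi$, $\mathrm{cro}(\sigma,\pi)$ is the number of pairs of arches $\{i,j\},\{k,\ell\}$ of $\sigma$ with $i<k<j<\ell$ and $\{i,j,k,\ell\}$ contained in a single block of $\pi$. The crossing graph $G(\sigma)$ has the arches of $\sigma$ as vertices and an edge between $\{i,j\}$ and $\{k,\ell\}$ iff $i<k<j<\ell$. -}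

module Defs where

open import Data.Bool using (Bool; true; false; _∧_; _∨_; not; if_then_else_)
open import Data.Nat using (ℕ; zero; suc; _+_; _*_; _≡ᵇ_; _<ᵇ_)
open import Data.Fin using (Fin; toℕ)
open import Data.Vec using (Vec; []; _∷_; lookup; replicate)
open import Data.List using (List; []; _∷_; map; concatMap; allFin; upTo; foldr)
open import Data.Product using (_×_; _,_)
open import Data.Integer using (ℤ; -_; 0ℤ; 1ℤ) renaming (_+_ to _+ℤ_)

-- Set partitions of an m-element set {0,…,m-1} (= Fin m), encoded as
-- restricted growth strings: π assigns to each element the label of its
-- block, blocks being numbered 0,1,2,… in order of their least element.
-- This is a bijective (canonical) encoding of set partitions.

Partition : ℕ → Set
Partition m = Vec ℕ m

-- rgs r b : all continuations of length r when b labels are already used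
rgs : (r : ℕ) → ℕ → List (Vec ℕ r)
rgs zero    b = [] ∷ []
rgs (suc r) b =
  concatMap (λ c → map (c ∷_) (rgs r (if c ≡ᵇ b then suc b else b)))
            (upTo (suc b))

partitions : (m : ℕ) → List (Partition m)
partitions m = rgs m 0

anyL : {A : Set} → List A → (A → Bool) → Bool
anyL xs p = foldr (λ x r → p x ∨ r) false xs

allL : {A : Set} → List A → (A → Bool) → Bool
allL xs p = foldr (λ x r → p x ∧ r) true xs

countL : {A : Set} → List A → (A → Bool) → ℕ
countL xs p = foldr (λ x r → if p x then suc r else r) 0 xs

sumℤ : List ℤ → ℤ
sumℤ = foldr _+ℤ_ 0ℤ

same : {m : ℕ} → Partition m → Fin m → Fin m → Bool
same π i j = lookup π i ≡ᵇ lookup π j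

leqP : {m : ℕ} → Partition m → Partition m → Bool
leqP {m} π ρ = allL (allFin m) (λ i → allL (allFin m) (λ j → not (same π i j) ∨ same ρ i j))

eqP : {m : ℕ} → Partition m → Partition m → Bool
eqP π ρ = leqP π ρ ∧ leqP ρ π

top : (m : ℕ) → Partition m
top m = replicate m 0

-- Möbius function of 𝒫(m), by the defining recursion
--   μ(x,x) = 1,  μ(x,y) = - Σ_{x < z ≤ y} μ(z,y)  (x < y),  μ(x,y) = 0 otherwise,
-- with a fuel argument (fuel ≥ length of longest chain + 1 suffices).
mobF : (m fuel : ℕ) → Partition m → Partition m → ℤ
mobF m zero     x y = 0ℤ
mobF m (suc f)  x y =
  if eqP x y then 1ℤ
  else if leqP x y
    then - sumℤ (map (λ z → if leqP x z ∧ not (leqP z x) ∧ leqP z y then mobF m f z y else 0ℤ)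
                     (partitions m))
    else 0ℤ

μ : (m : ℕ) → Partition m → Partition m → ℤ
μ m = mobF m (suc m)

IsMatching : {m : ℕ} → Partition m → Set
IsMatching {m} σ =
  (i : Fin m) → countL (allFin m) (λ j → not (toℕ j ≡ᵇ toℕ i) ∧ same σ i j) ≡ 1
  where open import Relation.Binary.PropositionalEquality using (_≡_)

Quad : ℕ → Set
Quad m = Fin m × Fin m × Fin m × Fin m

quads : (m : ℕ) → List (Quad m)
quads m = concatMap (λ i → concatMap (λ k → concatMap (λ j → map (λ l → (i , k , j , l))
            (allFin m)) (allFin m)) (allFin m)) (allFin m)

ordered : {m : ℕ} → Quad m → Bool
ordered (i , k , j , l) = (toℕ i <ᵇ toℕ k) ∧ (toℕ k <ᵇ toℕ j) ∧ (toℕ j <ᵇ toℕ l)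

-- Each such pair of arches
-- corresponds to exactly one quadruple i<k<j<l with {i,j},{k,l} blocks of σ.
cro : {m : ℕ} → Partition m → Partition m → ℕ
cro {m} σ π = countL (quads m) λ where
  (i , k , j , l) → ordered (i , k , j , l) ∧ same σ i j ∧ same σ k l
                    ∧ same π i k ∧ same π i j ∧ same π i l

-- Crossing graph G(σ) of a matching σ of Fin (2n): its vertices are the n
-- arches, identified with their block labels 0,…,n-1 (i.e. with Fin n).
crossesOrd : {m : ℕ} → Partition m → ℕ → ℕ → Bool
crossesOrd {m} σ a b = anyL (quads m) λ where
  (i , k , j , l) → ordered (i , k , j , l) ∧ (lookup σ i ≡ᵇ a) ∧ (lookup σ j ≡ᵇ a)
                    ∧ (lookup σ k ≡ᵇ b) ∧ (lookup σ l ≡ᵇ b)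

edge : {n : ℕ} → Partition (2 * n) → Fin n → Fin n → Bool
edge σ a b = crossesOrd σ (toℕ a) (toℕ b) ∨ crossesOrd σ (toℕ b) (toℕ a)

iE : {n : ℕ} → Partition (2 * n) → Partition n → ℕ
iE {n} σ π = countL (concatMap (λ a → map (λ b → (a , b)) (allFin n)) (allFin n)) λ where
  (a , b) → (toℕ a <ᵇ toℕ b) ∧ edge σ a b ∧ same π a b

-- Both sides of the identity are polynomials in q with integer
-- coefficients; we state the identity coefficientwise.

lhsCoeff : (n : ℕ) → Partition (2 * n) → ℕ → ℤ
lhsCoeff n σ k = sumℤ (map (λ π → if leqP σ π ∧ (cro σ π ≡ᵇ k) then μ (2 * n) π (top (2 * n)) else 0ℤ)
                           (partitions (2 * n)))

rhsCoeff : (n : ℕ) → Partition (2 * n) → ℕ → ℤ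
rhsCoeff n σ k = sumℤ (map (λ π → if iE σ π ≡ᵇ k then μ n π (top n) else 0ℤ) (partitions n))

module Submission where

-- The blocks of the matching σ are its arches, labelled 0,…,n−1.  Pulling a partition ρ of the arches back
-- along the arch map is an order isomorphism lift from 𝒫(n) onto the interval [σ, 1̂] of 𝒫(2n), so the
-- left-hand sum is a sum over ρ and μ(lift ρ, 1̂) = μ(ρ, 1̂).  A crossing counted by cro(σ, lift ρ) is a pair
-- of crossing arches lying in one block of ρ, i.e. an edge of G(σ) inside a block of ρ; hence
-- cro(σ, lift ρ) = i(E, ρ) and the two sums agree term by term.

open import Defs
open import Data.Nat using (ℕ; _≤_; _*_)
open import Data.List.Membership.Propositional using (_∈_)
open import Relation.Binary.PropositionalEquality using (_≡_)

open import Data.Bool using (Bool; true; false; _∧_; _∨_; not; if_then_else_; T)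
open import Data.Bool.Properties using (∧-zeroʳ; ∧-identityʳ; ∨-zeroʳ; ¬-not) renaming (_≟_ to _≟ᴮ_)
open import Data.Empty using (⊥; ⊥-elim)
open import Data.Fin using (Fin; zero; suc; toℕ; fromℕ<)
open import Data.Fin.Properties using (toℕ-injective; toℕ-fromℕ<; toℕ<n)
open import Data.Integer using (ℤ; 0ℤ; 1ℤ; -_) renaming (_+_ to _+ℤ_)
import Data.Integer.Properties as ℤ
open import Data.List using (List; []; _∷_; map; foldr; concatMap; length; upTo; allFin; filter)
open import Data.List.Properties using (length-upTo; length-tabulate; map-∘)
open import Data.List.Membership.Propositional using (find)
open import Data.List.Membership.Propositional.Properties
  using (∈-map⁺; ∈-map⁻; ∈-concatMap⁺; ∈-concatMap⁻; ∈-upTo⁺; ∈-upTo⁻; ∈-allFin; ∈-filter⁺; ∈-filter⁻)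
open import Data.List.Membership.Propositional.Properties.WithK using (unique∧set⇒bag)
open import Data.List.Relation.Binary.BagAndSetEquality using (∼bag⇒↭)
open import Data.List.Relation.Binary.Permutation.Propositional as ↭ using (_↭_)
import Data.List.Relation.Binary.Permutation.Propositional.Properties as ↭
open import Data.List.Relation.Unary.All as All using (All; []; _∷_)
open import Data.List.Relation.Unary.All.Properties using (concat⁺) renaming (map⁺ to All-map⁺)
open import Data.List.Relation.Unary.Any as Any using (here; there)
open import Data.List.Relation.Unary.AllPairs using ([]; _∷_)
open import Data.List.Relation.Unary.Unique.Propositional using (Unique)
open import Data.List.Relation.Unary.Unique.Propositional.Properties using (++⁺; map⁺; upTo⁺; allFin⁺; filter⁺)
open import Data.Nat.Base
open import Data.Nat.Properties
open import Algebra.Properties.CommutativeSemigroup +-commutativeSemigroup using (interchange)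
open import Data.Product using (∃-syntax; _×_; _,_; proj₁; proj₂)
open import Data.Sum using (_⊎_; inj₁; inj₂)
open import Data.Unit using (tt)
open import Data.Vec using (Vec; []; _∷_; lookup; tabulate; head)
open import Data.Vec.Properties
  using (lookup∘tabulate; tabulate∘lookup; tabulate-cong; lookup-replicate; ∷-injectiveʳ)
open import Function.Base using (_∘_)
open import Function.Bundles using (mk⇔)
open import Level using (0ℓ)
open import Relation.Binary.Definitions using (tri<; tri≈; tri>)
open import Relation.Binary.PropositionalEquality
  using (_≢_; refl; sym; trans; cong; cong₂; subst; subst₂; module ≡-Reasoning)
open import Relation.Nullary using (¬_; yes; no)
open import Relation.Unary using (Pred; Decidable)

∧-true⁻ : ∀ {a b} → (a ∧ b) ≡ true → a ≡ true × b ≡ true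
∧-true⁻ {true} b≡true = refl , b≡true

∧-true⁺ : ∀ {a b} → a ≡ true → b ≡ true → (a ∧ b) ≡ true
∧-true⁺ refl refl = refl

∨-true⁻ : ∀ {a b} → (a ∨ b) ≡ true → a ≡ true ⊎ b ≡ true
∨-true⁻ {true}  _       = inj₁ refl
∨-true⁻ {false} b≡true = inj₂ b≡true

∨-trueˡ : ∀ {a} b → a ≡ true → (a ∨ b) ≡ true
∨-trueˡ b refl = refl

∨-trueʳ : ∀ a {b} → b ≡ true → (a ∨ b) ≡ true
∨-trueʳ true  _       = refl
∨-trueʳ false b≡true = b≡true

⇒-true⁻ : ∀ {a b} → (not a ∨ b) ≡ true → a ≡ true → b ≡ true
⇒-true⁻ b≡true refl = b≡true

⇒-true⁺ : ∀ {a b} → (a ≡ true → b ≡ true) → (not a ∨ b) ≡ true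
⇒-true⁺ {true}  a⇒b = a⇒b refl
⇒-true⁺ {false} _   = refl

⇒-false⁻ : ∀ a b → (not a ∨ b) ≡ false → a ≡ true × b ≡ false
⇒-false⁻ true false _ = refl , refl

true⇔⇒≡ : ∀ {a b} → (a ≡ true → b ≡ true) → (b ≡ true → a ≡ true) → a ≡ b
true⇔⇒≡ {true}  {true}  _ _ = refl
true⇔⇒≡ {true}  {false} f _ = sym (f refl)
true⇔⇒≡ {false} {true}  _ g = g refl
true⇔⇒≡ {false} {false} _ _ = refl

T⇒≡true : ∀ {b} → T b → b ≡ true
T⇒≡true {true} _ = refl

≡true⇒T : ∀ {b} → b ≡ true → T b
≡true⇒T refl = tt

≡ᵇ-true⁻ : ∀ m n → (m ≡ᵇ n) ≡ true → m ≡ n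
≡ᵇ-true⁻ m n = ≡ᵇ⇒≡ m n ∘ ≡true⇒T

≡ᵇ-true⁺ : ∀ m n → m ≡ n → (m ≡ᵇ n) ≡ true
≡ᵇ-true⁺ m n = T⇒≡true ∘ ≡⇒≡ᵇ m n

≡ᵇ-refl : ∀ m → (m ≡ᵇ m) ≡ true
≡ᵇ-refl m = ≡ᵇ-true⁺ m m refl

≡ᵇ-false⁻ : ∀ m n → (m ≡ᵇ n) ≡ false → m ≢ n
≡ᵇ-false⁻ m .m m≡ᵇm≡false refl with () ← trans (sym m≡ᵇm≡false) (≡ᵇ-refl m)

≡ᵇ-false⁺ : ∀ m n → m ≢ n → (m ≡ᵇ n) ≡ false
≡ᵇ-false⁺ m n m≢n with m ≡ᵇ n in eq
... | true  = ⊥-elim (m≢n (≡ᵇ-true⁻ m n eq))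
... | false = refl

≡ᵇ-sym : ∀ m n → (m ≡ᵇ n) ≡ (n ≡ᵇ m)
≡ᵇ-sym m n = true⇔⇒≡ (λ e → ≡ᵇ-true⁺ n m (sym (≡ᵇ-true⁻ m n e)))
                     (λ e → ≡ᵇ-true⁺ m n (sym (≡ᵇ-true⁻ n m e)))

<ᵇ-true⁻ : ∀ m n → (m <ᵇ n) ≡ true → m < n
<ᵇ-true⁻ m n = <ᵇ⇒< m n ∘ ≡true⇒T

<ᵇ-true⁺ : ∀ {m n} → m < n → (m <ᵇ n) ≡ true
<ᵇ-true⁺ = T⇒≡true ∘ <⇒<ᵇ

sumL : {A : Set} → List A → (A → ℕ) → ℕ
sumL xs f = foldr (λ x r → f x + r) 0 xs

indicator : Bool → ℕ
indicator true  = 1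
indicator false = 0

false≢true : false ≢ true
false≢true ()

indicator-∧-cases : ∀ x e y {c : ℕ} → (x ≡ false → c ≡ 0) → (y ≡ false → c ≡ 0) →
  (x ≡ true → y ≡ true → c ≡ indicator e) → c ≡ indicator (x ∧ e ∧ y)
indicator-∧-cases false e y     x-false _       _    = x-false refl
indicator-∧-cases true  e false _       y-false _    = trans (y-false refl) (cong indicator (sym (∧-zeroʳ e)))
indicator-∧-cases true  e true  _       _       both = trans (both refl refl) (cong indicator (sym (∧-identityʳ e)))

module _ {A : Set} where

  countL≡sumL : (xs : List A) (p : A → Bool) → countL xs p ≡ sumL xs (indicator ∘ p)
  countL≡sumL []       p = refl
  countL≡sumL (x ∷ xs) p with p x
  ... | true  = cong suc (countL≡sumL xs p)
  ... | false = countL≡sumL xs p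

  sumL-cong : (xs : List A) {f g : A → ℕ} → (∀ x → x ∈ xs → f x ≡ g x) → sumL xs f ≡ sumL xs g
  sumL-cong []       f≗g = refl
  sumL-cong (x ∷ xs) f≗g = cong₂ _+_ (f≗g x (here refl)) (sumL-cong xs (λ y y∈ → f≗g y (there y∈)))

  countL-cong : (xs : List A) {p q : A → Bool} → (∀ x → x ∈ xs → p x ≡ q x) → countL xs p ≡ countL xs q
  countL-cong xs {p} {q} p≗q = begin
    countL xs p                 ≡⟨ countL≡sumL xs p ⟩
    sumL xs (indicator ∘ p)     ≡⟨ sumL-cong xs (λ x x∈ → cong indicator (p≗q x x∈)) ⟩
    sumL xs (indicator ∘ q)     ≡⟨ countL≡sumL xs q ⟨
    countL xs q                 ∎
    where open ≡-Reasoning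

  sumL-const : (xs : List A) (c : ℕ) → sumL xs (λ _ → c) ≡ c * length xs
  sumL-const []       c = sym (*-zeroʳ c)
  sumL-const (x ∷ xs) c = trans (cong (c +_) (sumL-const xs c)) (sym (*-suc c (length xs)))

  sumL-+ : (xs : List A) (f g : A → ℕ) → sumL xs (λ x → f x + g x) ≡ sumL xs f + sumL xs g
  sumL-+ []       f g = refl
  sumL-+ (x ∷ xs) f g rewrite sumL-+ xs f g = interchange (f x) (g x) (sumL xs f) (sumL xs g)

  countL-split : (xs : List A) (q p : A → Bool) →
    countL xs p ≡ countL xs (λ x → q x ∧ p x) + countL xs (λ x → not (q x) ∧ p x)
  countL-split []       q p = refl
  countL-split (x ∷ xs) q p with q x | p x
  ... | true  | true  = cong suc (countL-split xs q p)
  ... | true  | false = countL-split xs q p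
  ... | false | true  = trans (cong suc (countL-split xs q p)) (sym (+-suc _ _))
  ... | false | false = countL-split xs q p

  countL-zero : (xs : List A) (p : A → Bool) → (∀ x → x ∈ xs → p x ≡ false) → countL xs p ≡ 0
  countL-zero []       p _      = refl
  countL-zero (x ∷ xs) p ¬p rewrite ¬p x (here refl) = countL-zero xs p (λ y y∈ → ¬p y (there y∈))

  countL-pos : (xs : List A) (p : A → Bool) {x : A} → x ∈ xs → p x ≡ true → 1 ≤ countL xs p
  countL-pos (y ∷ xs) p (here refl) px rewrite px = s≤s z≤n
  countL-pos (y ∷ xs) p (there x∈) px with p y
  ... | true  = s≤s z≤n
  ... | false = countL-pos xs p x∈ px

  countL≤length : (xs : List A) (p : A → Bool) → countL xs p ≤ length xs
  countL≤length []       p = z≤n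
  countL≤length (x ∷ xs) p with p x
  ... | true  = s≤s (countL≤length xs p)
  ... | false = m≤n⇒m≤1+n (countL≤length xs p)

  countL-mono : (xs : List A) {p q : A → Bool} → (∀ x → p x ≡ true → q x ≡ true) → countL xs p ≤ countL xs q
  countL-mono []       p⇒q = z≤n
  countL-mono (x ∷ xs) {p} {q} p⇒q with p x in px | q x in qx
  ... | true  | true  = s≤s (countL-mono xs p⇒q)
  ... | true  | false with () ← trans (sym (p⇒q x px)) qx
  ... | false | true  = m≤n⇒m≤1+n (countL-mono xs p⇒q)
  ... | false | false = countL-mono xs p⇒q

  countL-mono-< : (xs : List A) {p q : A → Bool} → (∀ x → p x ≡ true → q x ≡ true) →
    {w : A} → w ∈ xs → q w ≡ true → p w ≡ false → countL xs p < countL xs q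
  countL-mono-< (x ∷ xs) {p} {q} p⇒q (here refl) qw pw rewrite qw | pw = s≤s (countL-mono xs p⇒q)
  countL-mono-< (x ∷ xs) {p} {q} p⇒q (there w∈) qw pw with p x in px | q x in qx
  ... | true  | true  = s≤s (countL-mono-< xs p⇒q w∈ qw pw)
  ... | true  | false with () ← trans (sym (p⇒q x px)) qx
  ... | false | true  = m≤n⇒m≤1+n (countL-mono-< xs p⇒q w∈ qw pw)
  ... | false | false = countL-mono-< xs p⇒q w∈ qw pw

  allL-true⁻ : (xs : List A) (p : A → Bool) → allL xs p ≡ true → ∀ x → x ∈ xs → p x ≡ true
  allL-true⁻ (y ∷ xs) p all x x∈ with p y in py
  allL-true⁻ (y ∷ xs) p all x (here refl) | true = py
  allL-true⁻ (y ∷ xs) p all x (there x∈) | true = allL-true⁻ xs p all x x∈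

  allL-true⁺ : (xs : List A) (p : A → Bool) → (∀ x → x ∈ xs → p x ≡ true) → allL xs p ≡ true
  allL-true⁺ []       p _  = refl
  allL-true⁺ (x ∷ xs) p ∀p rewrite ∀p x (here refl) = allL-true⁺ xs p (λ y y∈ → ∀p y (there y∈))

  allL-false⁻ : (xs : List A) (p : A → Bool) → allL xs p ≡ false → ∃[ x ] x ∈ xs × p x ≡ false
  allL-false⁻ (y ∷ xs) p all with p y in py
  ... | false = y , here refl , py
  ... | true  with allL-false⁻ xs p all
  ... | x , x∈ , px = x , there x∈ , px

  anyL-true⁻ : (xs : List A) (p : A → Bool) → anyL xs p ≡ true → ∃[ x ] x ∈ xs × p x ≡ true
  anyL-true⁻ (y ∷ xs) p any with p y in py
  ... | true  = y , here refl , py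
  ... | false with anyL-true⁻ xs p any
  ... | x , x∈ , px = x , there x∈ , px

  anyL-true⁺ : (xs : List A) (p : A → Bool) {x : A} → x ∈ xs → p x ≡ true → anyL xs p ≡ true
  anyL-true⁺ (y ∷ xs) p (here refl) px rewrite px = refl
  anyL-true⁺ (y ∷ xs) p (there x∈) px with p y
  ... | true  = refl
  ... | false = anyL-true⁺ xs p x∈ px

  anyL-false⁻ : (xs : List A) (p : A → Bool) → anyL xs p ≡ false → ∀ x → x ∈ xs → p x ≡ false
  anyL-false⁻ (y ∷ xs) p any x x∈ with p y in py
  anyL-false⁻ (y ∷ xs) p any x (here refl) | false = py
  anyL-false⁻ (y ∷ xs) p any x (there x∈) | false = anyL-false⁻ xs p any x x∈

  anyL-∨ : (xs : List A) (p q : A → Bool) → anyL xs (λ x → p x ∨ q x) ≡ anyL xs p ∨ anyL xs q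
  anyL-∨ []       p q = refl
  anyL-∨ (x ∷ xs) p q with p x | q x
  ... | true  | _     = refl
  ... | false | true  = sym (∨-zeroʳ _)
  ... | false | false = anyL-∨ xs p q

  countL-atMostOne : (xs : List A) (p : A → Bool) → Unique xs →
    (∀ {x y} → p x ≡ true → p y ≡ true → x ≡ y) → countL xs p ≡ indicator (anyL xs p)
  countL-atMostOne []       p _            _    = refl
  countL-atMostOne (x ∷ xs) p (x∉xs ∷ uxs) once with p x in px
  ... | true  = cong suc (countL-zero xs p others)
    where
    others : ∀ y → y ∈ xs → p y ≡ false
    others y y∈ with p y in py
    ... | false = refl
    ... | true with refl ← once px py = ⊥-elim (All.lookup x∉xs y∈ refl)
  ... | false = countL-atMostOne xs p uxs once

  countL-single : (xs : List A) (p : A → Bool) → Unique xs → (∀ {x y} → p x ≡ true → p y ≡ true → x ≡ y) →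
    {x : A} → x ∈ xs → p x ≡ true → countL xs p ≡ 1
  countL-single xs p uxs once x∈ px = trans (countL-atMostOne xs p uxs once) (cong indicator (anyL-true⁺ xs p x∈ px))

module _ {A B : Set} where

  sumL-swap : (xs : List A) (ys : List B) (f : A → B → ℕ) →
    sumL xs (λ x → sumL ys (f x)) ≡ sumL ys (λ y → sumL xs (λ x → f x y))
  sumL-swap []       ys f = sym (trans (sumL-const ys 0) (*-zeroˡ (length ys)))
  sumL-swap (x ∷ xs) ys f = trans (cong (sumL ys (f x) +_) (sumL-swap xs ys f))
                                  (sym (sumL-+ ys (f x) (λ y → sumL xs (λ x → f x y))))

  ∈-concatMap⁺′ : {xs : List A} (g : A → List B) {x : A} {y : B} → x ∈ xs → y ∈ g x → y ∈ concatMap g xs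
  ∈-concatMap⁺′ g x∈ y∈ = ∈-concatMap⁺ g (Any.map (λ { refl → y∈ }) x∈)

  All-concatMap⁺ : {P : B → Set} {g : A → List B} (xs : List A) → (∀ x → All P (g x)) → All P (concatMap g xs)
  All-concatMap⁺ xs all = concat⁺ (All-map⁺ (All.universal all xs))

  All-map-tag : (xs : List A) (f : A → B) {P : B → Set} → (∀ x → P (f x)) → All P (map f xs)
  All-map-tag xs f Pf = All-map⁺ (All.universal Pf xs)

  concatMap-unique : {g : A → List B} (tag : B → A) {xs : List A} → Unique xs → (∀ x → Unique (g x)) →
    (∀ x → All (λ y → tag y ≡ x) (g x)) → Unique (concatMap g xs)
  concatMap-unique tag {[]}     _            _   _      = []
  concatMap-unique {g} tag {x ∷ xs} (x∉xs ∷ uxs) ugx tagged =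
    ++⁺ (ugx x) (concatMap-unique tag uxs ugx tagged) disjoint
    where
    disjoint : ∀ {y} → y ∈ g x × y ∈ concatMap g xs → ⊥
    disjoint (y∈gx , y∈rest) with find (∈-concatMap⁻ g {xs = xs} y∈rest)
    ... | x' , x'∈xs , y∈gx' =
      All.lookup x∉xs x'∈xs (trans (sym (All.lookup (tagged x) y∈gx)) (All.lookup (tagged x') y∈gx'))

sumℤ-↭ : {xs ys : List ℤ} → xs ↭ ys → sumℤ xs ≡ sumℤ ys
sumℤ-↭ ↭.refl                = refl
sumℤ-↭ (↭.prep x p)          = cong (x +ℤ_) (sumℤ-↭ p)
sumℤ-↭ (↭.swap {xs} {ys} x y p) = begin
  x +ℤ (y +ℤ sumℤ xs)   ≡⟨ ℤ.+-assoc x y (sumℤ xs) ⟨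
  (x +ℤ y) +ℤ sumℤ xs   ≡⟨ cong₂ _+ℤ_ (ℤ.+-comm x y) (sumℤ-↭ p) ⟩
  (y +ℤ x) +ℤ sumℤ ys   ≡⟨ ℤ.+-assoc y x (sumℤ ys) ⟩
  y +ℤ (x +ℤ sumℤ ys)   ∎
  where open ≡-Reasoning
sumℤ-↭ (↭.trans p q)         = trans (sumℤ-↭ p) (sumℤ-↭ q)

module _ {A : Set} where

  sumℤ-map-cong : (xs : List A) {f g : A → ℤ} → (∀ x → x ∈ xs → f x ≡ g x) → sumℤ (map f xs) ≡ sumℤ (map g xs)
  sumℤ-map-cong []       _   = refl
  sumℤ-map-cong (x ∷ xs) f≗g = cong₂ _+ℤ_ (f≗g x (here refl)) (sumℤ-map-cong xs (λ y y∈ → f≗g y (there y∈)))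

  sumℤ-filter : {P : Pred A 0ℓ} (P? : Decidable P) (f : A → ℤ) (xs : List A) →
    (∀ x → x ∈ xs → ¬ P x → f x ≡ 0ℤ) → sumℤ (map f xs) ≡ sumℤ (map f (filter P? xs))
  sumℤ-filter P? f []       _   = refl
  sumℤ-filter P? f (x ∷ xs) f≡0 with P? x
  ... | yes _  = cong (f x +ℤ_) (sumℤ-filter P? f xs (λ y y∈ → f≡0 y (there y∈)))
  ... | no ¬px = begin
    f x +ℤ sumℤ (map f xs)                ≡⟨ cong (_+ℤ sumℤ (map f xs)) (f≡0 x (here refl) ¬px) ⟩
    0ℤ +ℤ sumℤ (map f xs)                 ≡⟨ ℤ.+-identityˡ _ ⟩
    sumℤ (map f xs)                       ≡⟨ sumℤ-filter P? f xs (λ y y∈ → f≡0 y (there y∈)) ⟩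
    sumℤ (map f (filter P? xs))           ∎
    where open ≡-Reasoning

module _ {A B : Set} where

  sumℤ-reindex : {P : Pred A 0ℓ} (P? : Decidable P) (f : A → ℤ) {φ : B → A} {xs : List A} {ys : List B} →
    Unique xs → Unique ys → (∀ {y y'} → φ y ≡ φ y' → y ≡ y') →
    (∀ {y} → y ∈ ys → φ y ∈ xs × P (φ y)) → (∀ {x} → x ∈ xs → P x → ∃[ y ] y ∈ ys × φ y ≡ x) →
    (∀ x → x ∈ xs → ¬ P x → f x ≡ 0ℤ) → sumℤ (map f xs) ≡ sumℤ (map (f ∘ φ) ys)
  sumℤ-reindex P? f {φ} {xs} {ys} uxs uys φ-inj into onto f≡0 = begin
    sumℤ (map f xs)                 ≡⟨ sumℤ-filter P? f xs f≡0 ⟩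
    sumℤ (map f (filter P? xs))     ≡⟨ sumℤ-↭ (↭.map⁺ f filter↭image) ⟩
    sumℤ (map f (map φ ys))         ≡⟨ cong sumℤ (map-∘ ys) ⟨
    sumℤ (map (f ∘ φ) ys)           ∎
    where
    open ≡-Reasoning
    to : ∀ {x} → x ∈ filter P? xs → x ∈ map φ ys
    to x∈ with x∈xs , px ← ∈-filter⁻ P? x∈ with y , y∈ , refl ← onto x∈xs px = ∈-map⁺ φ y∈
    from : ∀ {x} → x ∈ map φ ys → x ∈ filter P? xs
    from x∈ with y , y∈ , refl ← ∈-map⁻ φ x∈ = ∈-filter⁺ P? (proj₁ (into y∈)) (proj₂ (into y∈))
    filter↭image : filter P? xs ↭ map φ ys
    filter↭image = ∼bag⇒↭ (unique∧set⇒bag (filter⁺ P? uxs) (map⁺ φ-inj uys) (mk⇔ to from))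

lookup-ext : ∀ {A : Set} {k} (u v : Vec A k) → (∀ i → lookup u i ≡ lookup v i) → u ≡ v
lookup-ext u v u≗v = trans (sym (tabulate∘lookup u)) (trans (tabulate-cong u≗v) (tabulate∘lookup v))

maxEntry : ∀ {m} → Vec ℕ m → ℕ
maxEntry []      = 0
maxEntry (x ∷ v) = x ⊔ maxEntry v

lookup≤maxEntry : ∀ {m} (v : Vec ℕ m) i → lookup v i ≤ maxEntry v
lookup≤maxEntry (x ∷ v) zero    = m≤m⊔n x (maxEntry v)
lookup≤maxEntry (x ∷ v) (suc i) = ≤-trans (lookup≤maxEntry v i) (m≤n⊔m x (maxEntry v))

maxEntry-attained : ∀ {m} (v : Vec ℕ m) → 1 ≤ m → ∃[ i ] lookup v i ≡ maxEntry v
maxEntry-attained (x ∷ [])    _ = zero , sym (⊔-identityʳ x)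
maxEntry-attained (x ∷ v@(_ ∷ _)) _ with i , vi≡max ← maxEntry-attained v (s≤s z≤n) | ⊔-sel x (maxEntry v)
... | inj₁ x⊔≡x   = zero , sym x⊔≡x
... | inj₂ x⊔≡max = suc i , trans vi≡max (sym x⊔≡max)

-- Restricted growth strings

-- b is the next unused label, as in the second argument of rgs.
IsRGSFrom : {r : ℕ} → ℕ → Vec ℕ r → Set
IsRGSFrom {r} b v = ∀ i → lookup v i ≤ b ⊎ ∃[ j ] toℕ j < toℕ i × suc (lookup v j) ≡ lookup v i

IsRGS : {r : ℕ} → Vec ℕ r → Set
IsRGS = IsRGSFrom 0

nextFresh : ℕ → ℕ → ℕ
nextFresh c b = if c ≡ᵇ b then suc b else b

b≤nextFresh : ∀ c b → b ≤ nextFresh c b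
b≤nextFresh c b with c ≡ᵇ b
... | true  = n≤1+n b
... | false = ≤-refl

module _ {r : ℕ} where

  IsRGSFrom-∷⁺ : ∀ b c {w : Vec ℕ r} → c ≤ b → IsRGSFrom (nextFresh c b) w → IsRGSFrom b (c ∷ w)
  IsRGSFrom-∷⁺ b c c≤b w-rgs zero = inj₁ c≤b
  IsRGSFrom-∷⁺ b c c≤b w-rgs (suc i) with w-rgs i
  ... | inj₂ (j , j<i , e) = inj₂ (suc j , s<s j<i , e)
  ... | inj₁ le with c ≡ᵇ b in c≡ᵇb
  ... | false = inj₁ le
  ... | true with m≤n⇒m<n∨m≡n le
  ... | inj₁ lt = inj₁ (s≤s⁻¹ lt)
  ... | inj₂ eq = inj₂ (zero , z<s , trans (cong suc (≡ᵇ-true⁻ c b c≡ᵇb)) (sym eq))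

  IsRGSFrom-head : ∀ b c {w : Vec ℕ r} → IsRGSFrom b (c ∷ w) → c ≤ b
  IsRGSFrom-head b c rgs with rgs zero
  ... | inj₁ c≤b = c≤b

  IsRGSFrom-tail : ∀ b c {w : Vec ℕ r} → IsRGSFrom b (c ∷ w) → IsRGSFrom (nextFresh c b) w
  IsRGSFrom-tail b c rgs i with rgs (suc i)
  ... | inj₁ le = inj₁ (≤-trans le (b≤nextFresh c b))
  ... | inj₂ (suc j , s<s j<i , e) = inj₂ (j , j<i , e)
  ... | inj₂ (zero , _ , e) with c ≡ᵇ b in c≡ᵇb
  ... | true  = inj₁ (subst (_≤ suc b) e (s≤s (IsRGSFrom-head b c rgs)))
  ... | false = inj₁ (subst (_≤ b) e (≤∧≢⇒< (IsRGSFrom-head b c rgs) (≡ᵇ-false⁻ c b c≡ᵇb)))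

rgs-step : ℕ → (r : ℕ) → ℕ → List (Vec ℕ (suc r))
rgs-step b r c = map (c ∷_) (rgs r (nextFresh c b))

∈-rgs⁻ : ∀ r b {v : Vec ℕ r} → v ∈ rgs r b → IsRGSFrom b v
∈-rgs⁻ zero    b {[]} _ ()
∈-rgs⁻ (suc r) b v∈ with c , c∈ , v∈c ← find (∈-concatMap⁻ (rgs-step b r) {xs = upTo (suc b)} v∈)
                    with w , w∈ , refl ← ∈-map⁻ (c ∷_) v∈c
  = IsRGSFrom-∷⁺ b c (s≤s⁻¹ (∈-upTo⁻ c∈)) (∈-rgs⁻ r (nextFresh c b) w∈)

∈-rgs⁺ : ∀ r b {v : Vec ℕ r} → IsRGSFrom b v → v ∈ rgs r b
∈-rgs⁺ zero    b {[]}    _   = here refl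
∈-rgs⁺ (suc r) b {c ∷ w} rgs =
  ∈-concatMap⁺′ (rgs-step b r) (∈-upTo⁺ (s≤s (IsRGSFrom-head b c rgs)))
    (∈-map⁺ (c ∷_) (∈-rgs⁺ r (nextFresh c b) (IsRGSFrom-tail b c rgs)))

rgs-unique : ∀ r b → Unique (rgs r b)
rgs-unique zero    b = [] ∷ []
rgs-unique (suc r) b = concatMap-unique head (upTo⁺ (suc b))
  (λ c → map⁺ ∷-injectiveʳ (rgs-unique r (nextFresh c b)))
  (λ c → All-map-tag (rgs r (nextFresh c b)) _ (λ _ → refl))

∈-partitions⁻ : ∀ m {v : Partition m} → v ∈ partitions m → IsRGS v
∈-partitions⁻ m = ∈-rgs⁻ m 0

∈-partitions⁺ : ∀ m {v : Partition m} → IsRGS v → v ∈ partitions m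
∈-partitions⁺ m = ∈-rgs⁺ m 0

partitions-unique : ∀ m → Unique (partitions m)
partitions-unique m = rgs-unique m 0

module _ {m : ℕ} where

  smaller-label-earlier : (v : Vec ℕ m) → IsRGS v → ∀ c (i : Fin m) → lookup v i ≡ c → ∀ a → a < c →
    ∃[ j ] toℕ j < toℕ i × lookup v j ≡ a
  smaller-label-earlier v v-rgs (suc c) i vi≡ a a<c with v-rgs i
  ... | inj₁ le with () ← subst (_≤ 0) vi≡ le
  ... | inj₂ (j , j<i , e) with m≤n⇒m<n∨m≡n (s≤s⁻¹ a<c)
  ... | inj₂ refl = j , j<i , suc-injective (trans e vi≡)
  ... | inj₁ a<c' with k , k<j , vk≡ ← smaller-label-earlier v v-rgs c j (suc-injective (trans e vi≡)) a a<c'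
    = k , <-trans k<j j<i , vk≡

-- Block leaders and the number of blocks

module _ {m : ℕ} where

  same-true⁻ : (x : Vec ℕ m) (i j : Fin m) → same x i j ≡ true → lookup x i ≡ lookup x j
  same-true⁻ x i j = ≡ᵇ-true⁻ (lookup x i) (lookup x j)

  same-true⁺ : (x : Vec ℕ m) (i j : Fin m) → lookup x i ≡ lookup x j → same x i j ≡ true
  same-true⁺ x i j = ≡ᵇ-true⁺ (lookup x i) (lookup x j)

  isLeader : Vec ℕ m → Fin m → Bool
  isLeader x i = not (anyL (allFin m) (λ j → (toℕ j <ᵇ toℕ i) ∧ same x j i))

  isLeader-true⁻ : ∀ (x : Vec ℕ m) i → isLeader x i ≡ true → ∀ j → toℕ j < toℕ i → lookup x j ≢ lookup x i
  isLeader-true⁻ x i leader j j<i xj≡xi with anyL (allFin m) (λ j → (toℕ j <ᵇ toℕ i) ∧ same x j i) in none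
  isLeader-true⁻ x i refl j j<i xj≡xi | false
    with () ← trans (sym (anyL-false⁻ (allFin m) _ none j (∈-allFin j)))
                    (∧-true⁺ (<ᵇ-true⁺ j<i) (same-true⁺ x j i xj≡xi))

  isLeader-true⁺ : ∀ (x : Vec ℕ m) i → (∀ j → toℕ j < toℕ i → lookup x j ≢ lookup x i) → isLeader x i ≡ true
  isLeader-true⁺ x i first with anyL (allFin m) (λ j → (toℕ j <ᵇ toℕ i) ∧ same x j i) in some
  ... | false = refl
  ... | true with j , _ , e ← anyL-true⁻ (allFin m) _ some
    = ⊥-elim (first j (<ᵇ-true⁻ _ _ (proj₁ (∧-true⁻ e))) (same-true⁻ x j i (proj₂ (∧-true⁻ e))))

  isLeader-false⁺ : ∀ (x : Vec ℕ m) i j → toℕ i < toℕ j → lookup x i ≡ lookup x j → isLeader x j ≡ false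
  isLeader-false⁺ x i j i<j xi≡xj with isLeader x j in leader
  ... | false = refl
  ... | true  = ⊥-elim (isLeader-true⁻ x j leader i i<j xi≡xj)

  private
    leader-below : ∀ (x : Vec ℕ m) fuel (i : Fin m) → toℕ i < fuel →
      ∃[ l ] isLeader x l ≡ true × lookup x l ≡ lookup x i × toℕ l ≤ toℕ i
    leader-below x (suc fuel) i i<fuel with anyL (allFin m) (λ j → (toℕ j <ᵇ toℕ i) ∧ same x j i) in some
    ... | false = i , cong not some , refl , ≤-refl
    ... | true with j , _ , e ← anyL-true⁻ (allFin m) _ some
               with j<i , xj≡xi ← ∧-true⁻ e
               with l , leader , xl≡xj , l≤j ← leader-below x fuel j (≤-trans (<ᵇ-true⁻ _ _ j<i) (s≤s⁻¹ i<fuel))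
      = l , leader , trans xl≡xj (same-true⁻ x j i xj≡xi) , ≤-trans l≤j (<⇒≤ (<ᵇ-true⁻ _ _ j<i))

  leader : ∀ (x : Vec ℕ m) (i : Fin m) → ∃[ l ] isLeader x l ≡ true × lookup x l ≡ lookup x i × toℕ l ≤ toℕ i
  leader x i = leader-below x (suc (toℕ i)) i ≤-refl

  before-leader-smaller : (v : Vec ℕ m) → IsRGS v → ∀ l → isLeader v l ≡ true →
    ∀ j → toℕ j < toℕ l → lookup v j < lookup v l
  before-leader-smaller v v-rgs l leader j j<l with <-cmp (lookup v j) (lookup v l)
  ... | tri< lt _ _ = lt
  ... | tri≈ _ eq _ = ⊥-elim (isLeader-true⁻ v l leader j j<l eq)
  ... | tri> _ _ gt with k , k<j , vk≡vl ← smaller-label-earlier v v-rgs (lookup v j) j refl (lookup v l) gt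
    = ⊥-elim (isLeader-true⁻ v l leader k (<-trans k<j j<l) vk≡vl)

  #blocks : Vec ℕ m → ℕ
  #blocks x = countL (allFin m) (isLeader x)

  #blocks≤ : ∀ x → #blocks x ≤ m
  #blocks≤ x = subst (#blocks x ≤_) (length-tabulate {n = m} (λ i → i)) (countL≤length (allFin m) (isLeader x))

module _ {m : ℕ} where

  leqP-true⁻ : (x y : Vec ℕ m) → leqP x y ≡ true → ∀ i j → same x i j ≡ true → same y i j ≡ true
  leqP-true⁻ x y x≤y i j =
    ⇒-true⁻ (allL-true⁻ (allFin m) _ (allL-true⁻ (allFin m) _ x≤y i (∈-allFin i)) j (∈-allFin j))

  leqP-true⁺ : (x y : Vec ℕ m) → (∀ i j → same x i j ≡ true → same y i j ≡ true) → leqP x y ≡ true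
  leqP-true⁺ x y x≤y = allL-true⁺ (allFin m) _ (λ i _ → allL-true⁺ (allFin m) _ (λ j _ → ⇒-true⁺ (x≤y i j)))

  leqP-trans : (x y z : Vec ℕ m) → leqP x y ≡ true → leqP y z ≡ true → leqP x z ≡ true
  leqP-trans x y z x≤y y≤z = leqP-true⁺ x z (λ i j s → leqP-true⁻ y z y≤z i j (leqP-true⁻ x y x≤y i j s))

  leader-antitone : ∀ (x z : Vec ℕ m) → leqP x z ≡ true → ∀ i → isLeader z i ≡ true → isLeader x i ≡ true
  leader-antitone x z x≤z i leader = isLeader-true⁺ x i λ j j<i xj≡xi →
    isLeader-true⁻ z i leader j j<i (same-true⁻ z j i (leqP-true⁻ x z x≤z j i (same-true⁺ x j i xj≡xi)))

  -- A strictly coarser partition merges two blocks, whose later leader stops being a leader.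
  #blocks-strict : ∀ (x z : Vec ℕ m) → leqP x z ≡ true → leqP z x ≡ false → #blocks z < #blocks x
  #blocks-strict x z x≤z z≰x
    with i , _ , ei ← allL-false⁻ (allFin m) _ z≰x
    with j , _ , ej ← allL-false⁻ (allFin m) _ ei
    with zij , xij ← ⇒-false⁻ (same z i j) (same x i j) ej
    with a , a-leader , xa≡xi , _ ← leader x i
    with b , b-leader , xb≡xj , _ ← leader x j
    = by-order (<-cmp (toℕ a) (toℕ b))
    where
    za≡zb : lookup z a ≡ lookup z b
    za≡zb = trans (same-true⁻ z a i (leqP-true⁻ x z x≤z a i (same-true⁺ x a i xa≡xi)))
              (trans (same-true⁻ z i j zij) (sym (same-true⁻ z b j (leqP-true⁻ x z x≤z b j (same-true⁺ x b j xb≡xj)))))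
    by-order : _ → #blocks z < #blocks x
    by-order (tri< a<b _ _) = countL-mono-< (allFin m) (leader-antitone x z x≤z) (∈-allFin b) b-leader
                               (isLeader-false⁺ z a b a<b za≡zb)
    by-order (tri> _ _ b<a) = countL-mono-< (allFin m) (leader-antitone x z x≤z) (∈-allFin a) a-leader
                               (isLeader-false⁺ z b a b<a (sym za≡zb))
    by-order (tri≈ _ a≡b _) = ⊥-elim (≡ᵇ-false⁻ (lookup x i) (lookup x j) xij
                               (trans (sym xa≡xi) (trans (cong (lookup x) (toℕ-injective a≡b)) xb≡xj)))

-- The Möbius function

module _ {m : ℕ} where

  mobF-suc : ∀ f (x y : Vec ℕ m) → #blocks x < f → mobF m f x y ≡ mobF m (suc f) x y
  mobF-suc (suc f) x y blocks<f =
    cong (λ s → if eqP x y then 1ℤ else if leqP x y then - s else 0ℤ) (sumℤ-map-cong (partitions m) term≡)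
    where
    term≡ : ∀ z → z ∈ partitions m →
      (if leqP x z ∧ not (leqP z x) ∧ leqP z y then mobF m f z y else 0ℤ) ≡
      (if leqP x z ∧ not (leqP z x) ∧ leqP z y then mobF m (suc f) z y else 0ℤ)
    term≡ z _ with leqP x z in x≤z | leqP z x in z≤x
    ... | false | _     = refl
    ... | true  | true  = refl
    ... | true  | false = cong (λ μzy → if leqP z y then μzy else 0ℤ)
                              (mobF-suc f z y (≤-trans (#blocks-strict x z x≤z z≤x) (s≤s⁻¹ blocks<f)))

  mobF-+ : ∀ k f (x y : Vec ℕ m) → #blocks x < f → mobF m f x y ≡ mobF m (k + f) x y
  mobF-+ zero    f x y blocks<f = refl
  mobF-+ (suc k) f x y blocks<f = trans (mobF-+ k f x y blocks<f) (mobF-suc (k + f) x y (≤-trans blocks<f (m≤n+m f k)))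

quads-unique : ∀ m → Unique (quads m)
quads-unique m =
  concatMap-unique proj₁ (allFin⁺ m)
    (λ i → concatMap-unique (proj₁ ∘ proj₂) (allFin⁺ m)
      (λ k → concatMap-unique (proj₁ ∘ proj₂ ∘ proj₂) (allFin⁺ m)
        (λ j → map⁺ (cong (proj₂ ∘ proj₂ ∘ proj₂)) (allFin⁺ m))
        (λ j → All-map-tag F _ (λ _ → refl)))
      (λ k → All-concatMap⁺ F (λ j → All-map-tag F _ (λ _ → refl))))
    (λ i → All-concatMap⁺ F (λ k → All-concatMap⁺ F (λ j → All-map-tag F _ (λ _ → refl))))
  where
  F : List (Fin m)
  F = allFin m

pairs : (n : ℕ) → List (Fin n × Fin n)
pairs n = concatMap (λ a → map (λ b → (a , b)) (allFin n)) (allFin n)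

pairs-unique : ∀ n → Unique (pairs n)
pairs-unique n = concatMap-unique proj₁ (allFin⁺ n) (λ a → map⁺ (cong proj₂) (allFin⁺ n))
  (λ a → All-map-tag (allFin n) _ (λ _ → refl))

∈-pairs : ∀ {n} (a b : Fin n) → (a , b) ∈ pairs n
∈-pairs a b = ∈-concatMap⁺′ _ (∈-allFin a) (∈-map⁺ _ (∈-allFin b))

module _ {m : ℕ} where

  ordered-true⁻ : ∀ (i k j l : Fin m) → ordered (i , k , j , l) ≡ true →
    toℕ i < toℕ k × toℕ k < toℕ j × toℕ j < toℕ l
  ordered-true⁻ i k j l ord with i<k , rest ← ∧-true⁻ ord with k<j , j<l ← ∧-true⁻ {toℕ k <ᵇ toℕ j} rest
    = <ᵇ-true⁻ _ _ i<k , <ᵇ-true⁻ _ _ k<j , <ᵇ-true⁻ _ _ j<l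

  crossingIn : Partition m → Partition m → Quad m → Bool
  crossingIn σ π (i , k , j , l) =
    ordered (i , k , j , l) ∧ same σ i j ∧ same σ k l ∧ same π i k ∧ same π i j ∧ same π i l

  crossesVia : Partition m → ℕ → ℕ → Quad m → Bool
  crossesVia σ a b (i , k , j , l) =
    ordered (i , k , j , l) ∧ (lookup σ i ≡ᵇ a) ∧ (lookup σ j ≡ᵇ a) ∧ (lookup σ k ≡ᵇ b) ∧ (lookup σ l ≡ᵇ b)

  crossesVia-true⁻ : ∀ σ a b (i k j l : Fin m) → crossesVia σ a b (i , k , j , l) ≡ true →
    ordered (i , k , j , l) ≡ true × lookup σ i ≡ a × lookup σ j ≡ a × lookup σ k ≡ b × lookup σ l ≡ b
  crossesVia-true⁻ σ a b i k j l cv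
    with ord , r₁ ← ∧-true⁻ cv
    with σi , r₂ ← ∧-true⁻ r₁
    with σj , r₃ ← ∧-true⁻ r₂
    with σk , σl ← ∧-true⁻ r₃
    = ord , ≡ᵇ-true⁻ _ _ σi , ≡ᵇ-true⁻ _ _ σj , ≡ᵇ-true⁻ _ _ σk , ≡ᵇ-true⁻ _ _ σl

  crossingIn-true⁻ : ∀ σ π (i k j l : Fin m) → crossingIn σ π (i , k , j , l) ≡ true →
    ordered (i , k , j , l) ≡ true × lookup σ i ≡ lookup σ j × lookup σ k ≡ lookup σ l × same π i k ≡ true
  crossingIn-true⁻ σ π i k j l c
    with ord , r₁ ← ∧-true⁻ c
    with σij , r₂ ← ∧-true⁻ r₁
    with σkl , r₃ ← ∧-true⁻ r₂
    = ord , same-true⁻ σ i j σij , same-true⁻ σ k l σkl , proj₁ (∧-true⁻ r₃)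

  crossesVia-true⁺ : ∀ σ {a b} (i k j l : Fin m) → ordered (i , k , j , l) ≡ true →
    lookup σ i ≡ a → lookup σ j ≡ a → lookup σ k ≡ b → lookup σ l ≡ b → crossesVia σ a b (i , k , j , l) ≡ true
  crossesVia-true⁺ σ i k j l ord σi σj σk σl =
    ∧-true⁺ ord (∧-true⁺ (≡ᵇ-true⁺ _ _ σi) (∧-true⁺ (≡ᵇ-true⁺ _ _ σj)
      (∧-true⁺ (≡ᵇ-true⁺ _ _ σk) (≡ᵇ-true⁺ _ _ σl))))

-- The matching σ, its arches and the partitions above it

module Arches (n : ℕ) (n≥1 : 1 ≤ n) (σ : Partition (2 * n)) (σ-rgs : IsRGS σ) (σ-matching : IsMatching σ) where

  m : ℕ
  m = 2 * n

  block-size : ∀ i → countL (allFin m) (λ j → lookup σ j ≡ᵇ lookup σ i) ≡ 2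
  block-size i = trans (countL-split (allFin m) (λ j → toℕ j ≡ᵇ toℕ i) _)
    (cong₂ _+_
      (trans (countL-cong (allFin m) itself) (countL-single (allFin m) _ (allFin⁺ m) toℕ-≡ (∈-allFin i) (≡ᵇ-refl (toℕ i))))
      (trans (countL-cong (allFin m) partner) (σ-matching i)))
    where
    toℕ-≡ : ∀ {j j'} → (toℕ j ≡ᵇ toℕ i) ≡ true → (toℕ j' ≡ᵇ toℕ i) ≡ true → j ≡ j'
    toℕ-≡ {j} {j'} e e' = toℕ-injective (trans (≡ᵇ-true⁻ _ _ e) (sym (≡ᵇ-true⁻ _ _ e')))
    itself : ∀ j → j ∈ allFin m → ((toℕ j ≡ᵇ toℕ i) ∧ (lookup σ j ≡ᵇ lookup σ i)) ≡ (toℕ j ≡ᵇ toℕ i)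
    itself j _ with toℕ j ≡ᵇ toℕ i in j≡i
    ... | false = refl
    ... | true with refl ← toℕ-injective {i = j} {j = i} (≡ᵇ-true⁻ _ _ j≡i) = ≡ᵇ-refl (lookup σ j)
    partner : ∀ j → j ∈ allFin m →
      (not (toℕ j ≡ᵇ toℕ i) ∧ (lookup σ j ≡ᵇ lookup σ i)) ≡ (not (toℕ j ≡ᵇ toℕ i) ∧ same σ i j)
    partner j _ = cong (not (toℕ j ≡ᵇ toℕ i) ∧_) (≡ᵇ-sym (lookup σ j) (lookup σ i))

  no-three-in-block : ∀ (i j k : Fin m) → toℕ i ≢ toℕ j → toℕ i ≢ toℕ k → toℕ j ≢ toℕ k →
    lookup σ i ≡ lookup σ j → lookup σ i ≡ lookup σ k → ⊥
  no-three-in-block i j k i≢j i≢k j≢k σi≡σj σi≡σk =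
    <-irrefl (sym (σ-matching i))
      (≤-trans (+-mono-≤ j-counted k-counted) (≤-reflexive (sym (countL-split (allFin m) (λ x → toℕ x ≡ᵇ toℕ j) _))))
    where
    j-counted : 1 ≤ countL (allFin m) (λ x → (toℕ x ≡ᵇ toℕ j) ∧ (not (toℕ x ≡ᵇ toℕ i) ∧ same σ i x))
    j-counted = countL-pos (allFin m) _ (∈-allFin j)
      (∧-true⁺ (≡ᵇ-refl (toℕ j)) (∧-true⁺ (cong not (≡ᵇ-false⁺ _ _ (i≢j ∘ sym))) (same-true⁺ σ i j σi≡σj)))
    k-counted : 1 ≤ countL (allFin m) (λ x → not (toℕ x ≡ᵇ toℕ j) ∧ (not (toℕ x ≡ᵇ toℕ i) ∧ same σ i x))
    k-counted = countL-pos (allFin m) _ (∈-allFin k)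
      (∧-true⁺ (cong not (≡ᵇ-false⁺ _ _ (j≢k ∘ sym)))
        (∧-true⁺ (cong not (≡ᵇ-false⁺ _ _ (i≢k ∘ sym))) (same-true⁺ σ i k σi≡σk)))

  maxLabel : ℕ
  maxLabel = maxEntry σ

  label-≤max-occurs : ∀ a → a ≤ maxLabel → ∃[ i ] lookup σ i ≡ a
  label-≤max-occurs a a≤max with maxEntry-attained σ (≤-trans n≥1 (m≤m+n n (n + 0)))
  ... | imax , σimax≡max with m≤n⇒m<n∨m≡n a≤max
  ... | inj₂ refl = imax , σimax≡max
  ... | inj₁ a<max with j , _ , σj≡a ← smaller-label-earlier σ σ-rgs maxLabel imax σimax≡max a a<max = j , σj≡a

  -- Count the pairs (point, label) with matching label in two ways; every block has two points.
  m≡2[max+1] : m ≡ 2 * suc maxLabel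
  m≡2[max+1] = begin
    m                                                                  ≡⟨ length-tabulate {n = m} (λ i → i) ⟨
    length (allFin m)                                                  ≡⟨ trans (sumL-const (allFin m) 1) (*-identityˡ _) ⟨
    sumL (allFin m) (λ _ → 1)                                          ≡⟨ sumL-cong (allFin m) one-label ⟩
    sumL (allFin m) (λ j → sumL labels (λ a → indicator (lookup σ j ≡ᵇ a)))  ≡⟨ sumL-swap (allFin m) labels _ ⟩
    sumL labels (λ a → sumL (allFin m) (λ j → indicator (lookup σ j ≡ᵇ a)))  ≡⟨ sumL-cong labels two-points ⟩
    sumL labels (λ _ → 2)                                              ≡⟨ sumL-const labels 2 ⟩
    2 * length labels                                                  ≡⟨ cong (2 *_) (length-upTo (suc maxLabel)) ⟩
    2 * suc maxLabel                                                   ∎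
    where
    open ≡-Reasoning
    labels : List ℕ
    labels = upTo (suc maxLabel)
    one-label : ∀ j → j ∈ allFin m → 1 ≡ sumL labels (λ a → indicator (lookup σ j ≡ᵇ a))
    one-label j _ = sym (trans (sym (countL≡sumL labels _))
      (countL-single labels _ (upTo⁺ (suc maxLabel))
        (λ {a} {a'} e e' → trans (sym (≡ᵇ-true⁻ (lookup σ j) a e)) (≡ᵇ-true⁻ (lookup σ j) a' e'))
        (∈-upTo⁺ (s≤s (lookup≤maxEntry σ j))) (≡ᵇ-refl (lookup σ j))))
    two-points : ∀ a → a ∈ labels → sumL (allFin m) (λ j → indicator (lookup σ j ≡ᵇ a)) ≡ 2
    two-points a a∈ with i , refl ← label-≤max-occurs a (s≤s⁻¹ (∈-upTo⁻ a∈))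
      = trans (sym (countL≡sumL (allFin m) _)) (block-size i)

  n≡max+1 : n ≡ suc maxLabel
  n≡max+1 = *-cancelˡ-≡ n (suc maxLabel) 2 m≡2[max+1]

  label<n : ∀ i → lookup σ i < n
  label<n i = subst (lookup σ i <_) (sym n≡max+1) (s≤s (lookup≤maxEntry σ i))

  label-occurs : ∀ a → a < n → ∃[ i ] lookup σ i ≡ a
  label-occurs a a<n = label-≤max-occurs a (s≤s⁻¹ (subst (a <_) n≡max+1 a<n))

  -- Arches are numbered by their labels in σ; lift ρ is the partition of the points whose blocks are unions
  -- of the arches in the blocks of ρ, and collapse is its inverse on the partitions above σ.
  opaque
    arch : Fin m → Fin n
    arch i = fromℕ< (label<n i)

    toℕ-arch : ∀ i → toℕ (arch i) ≡ lookup σ i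
    toℕ-arch i = toℕ-fromℕ< (label<n i)

    opener : Fin n → Fin m
    opener a = proj₁ (leader σ (proj₁ (label-occurs (toℕ a) (toℕ<n a))))

    label-opener : ∀ a → lookup σ (opener a) ≡ toℕ a
    label-opener a = trans (proj₁ (proj₂ (proj₂ (leader σ (proj₁ (label-occurs (toℕ a) (toℕ<n a)))))))
                           (proj₂ (label-occurs (toℕ a) (toℕ<n a)))

    opener-isLeader : ∀ a → isLeader σ (opener a) ≡ true
    opener-isLeader a = proj₁ (proj₂ (leader σ (proj₁ (label-occurs (toℕ a) (toℕ<n a)))))

    lift : Partition n → Partition m
    lift ρ = tabulate (lookup ρ ∘ arch)

    lookup-lift : ∀ ρ i → lookup (lift ρ) i ≡ lookup ρ (arch i)
    lookup-lift ρ i = lookup∘tabulate _ i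

    collapse : Partition m → Partition n
    collapse π = tabulate (lookup π ∘ opener)

    lookup-collapse : ∀ π a → lookup (collapse π) a ≡ lookup π (opener a)
    lookup-collapse π a = lookup∘tabulate _ a

  arch-≡ : ∀ i (a : Fin n) → lookup σ i ≡ toℕ a → arch i ≡ a
  arch-≡ i a σi≡a = toℕ-injective (trans (toℕ-arch i) σi≡a)

  arch-opener : ∀ a → arch (opener a) ≡ a
  arch-opener a = arch-≡ (opener a) a (label-opener a)

  same-arch : ∀ i j → lookup σ i ≡ lookup σ j → arch i ≡ arch j
  same-arch i j σi≡σj = arch-≡ i (arch j) (trans σi≡σj (sym (toℕ-arch j)))

  same-lift : ∀ ρ i j → same (lift ρ) i j ≡ same ρ (arch i) (arch j)
  same-lift ρ i j = cong₂ _≡ᵇ_ (lookup-lift ρ i) (lookup-lift ρ j)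

  leqP-lift : ∀ ρ ρ' → leqP (lift ρ) (lift ρ') ≡ leqP ρ ρ'
  leqP-lift ρ ρ' = true⇔⇒≡ restrict extend
    where
    restrict : leqP (lift ρ) (lift ρ') ≡ true → leqP ρ ρ' ≡ true
    restrict ρ≤ρ' = leqP-true⁺ ρ ρ' λ a b s →
      subst₂ (λ u v → same ρ' u v ≡ true) (arch-opener a) (arch-opener b)
        (trans (sym (same-lift ρ' (opener a) (opener b)))
          (leqP-true⁻ (lift ρ) (lift ρ') ρ≤ρ' (opener a) (opener b)
            (trans (same-lift ρ (opener a) (opener b))
              (subst₂ (λ u v → same ρ u v ≡ true) (sym (arch-opener a)) (sym (arch-opener b)) s))))
    extend : leqP ρ ρ' ≡ true → leqP (lift ρ) (lift ρ') ≡ true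
    extend ρ≤ρ' = leqP-true⁺ (lift ρ) (lift ρ') λ i j s →
      trans (same-lift ρ' i j) (leqP-true⁻ ρ ρ' ρ≤ρ' (arch i) (arch j) (trans (sym (same-lift ρ i j)) s))

  eqP-lift : ∀ ρ ρ' → eqP (lift ρ) (lift ρ') ≡ eqP ρ ρ'
  eqP-lift ρ ρ' = cong₂ _∧_ (leqP-lift ρ ρ') (leqP-lift ρ' ρ)

  lift-top : lift (top n) ≡ top m
  lift-top = lookup-ext _ _ λ i →
    trans (lookup-lift (top n) i) (trans (lookup-replicate (arch i) 0) (sym (lookup-replicate i 0)))

  σ≤lift : ∀ ρ → leqP σ (lift ρ) ≡ true
  σ≤lift ρ = leqP-true⁺ σ (lift ρ) λ i j s → same-true⁺ (lift ρ) i j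
    (trans (lookup-lift ρ i) (trans (cong (lookup ρ) (same-arch i j (same-true⁻ σ i j s))) (sym (lookup-lift ρ j))))

  lift-injective : ∀ {ρ ρ'} → lift ρ ≡ lift ρ' → ρ ≡ ρ'
  lift-injective {ρ} {ρ'} eq = lookup-ext ρ ρ' λ a → begin
    lookup ρ a                      ≡⟨ cong (lookup ρ) (arch-opener a) ⟨
    lookup ρ (arch (opener a))      ≡⟨ lookup-lift ρ (opener a) ⟨
    lookup (lift ρ) (opener a)      ≡⟨ cong (λ v → lookup v (opener a)) eq ⟩
    lookup (lift ρ') (opener a)     ≡⟨ lookup-lift ρ' (opener a) ⟩
    lookup ρ' (arch (opener a))     ≡⟨ cong (lookup ρ') (arch-opener a) ⟩
    lookup ρ' a                     ∎
    where open ≡-Reasoning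

  lift-rgs : ∀ ρ → IsRGS ρ → IsRGS (lift ρ)
  lift-rgs ρ ρ-rgs i with ρ-rgs (arch i)
  ... | inj₁ le = inj₁ (subst (_≤ 0) (sym (lookup-lift ρ i)) le)
  ... | inj₂ (a' , a'<i , e)
    with j , j<i , σj≡a' ← smaller-label-earlier σ σ-rgs (lookup σ i) i refl (toℕ a') (subst (toℕ a' <_) (toℕ-arch i) a'<i)
    = inj₂ (j , j<i , trans (cong suc (trans (lookup-lift ρ j) (cong (lookup ρ) (arch-≡ j a' σj≡a'))))
                            (trans e (sym (lookup-lift ρ i))))

  σ≤⇒same-opener : ∀ π → leqP σ π ≡ true → ∀ i → lookup π (opener (arch i)) ≡ lookup π i
  σ≤⇒same-opener π σ≤π i = same-true⁻ π _ i
    (leqP-true⁻ σ π σ≤π _ i (same-true⁺ σ _ i (trans (label-opener (arch i)) (toℕ-arch i))))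

  lift-collapse : ∀ π → leqP σ π ≡ true → lift (collapse π) ≡ π
  lift-collapse π σ≤π = lookup-ext _ _ λ i →
    trans (lookup-lift (collapse π) i) (trans (lookup-collapse π (arch i)) (σ≤⇒same-opener π σ≤π i))

  -- Openers of arches appear in increasing order of the arch labels, as σ is a restricted growth string.
  collapse-rgs : ∀ π → IsRGS π → leqP σ π ≡ true → IsRGS (collapse π)
  collapse-rgs π π-rgs σ≤π a with π-rgs (opener a)
  ... | inj₁ le = inj₁ (subst (_≤ 0) (sym (lookup-collapse π a)) le)
  ... | inj₂ (j , j<opener , e) = inj₂ (arch j , arch-j<a , trans (cong suc πj) (trans e (sym (lookup-collapse π a))))
    where
    arch-j<a : toℕ (arch j) < toℕ a
    arch-j<a = subst₂ _<_ (sym (toℕ-arch j)) (label-opener a)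
                 (before-leader-smaller σ σ-rgs (opener a) (opener-isLeader a) j j<opener)
    πj : lookup (collapse π) (arch j) ≡ lookup π j
    πj = trans (lookup-collapse π (arch j)) (σ≤⇒same-opener π σ≤π j)

  sum-above-σ : (f : Partition m → ℤ) → (∀ π → π ∈ partitions m → leqP σ π ≢ true → f π ≡ 0ℤ) →
    sumℤ (map f (partitions m)) ≡ sumℤ (map (f ∘ lift) (partitions n))
  sum-above-σ f f≡0 = sumℤ-reindex (λ π → leqP σ π ≟ᴮ true) f {φ = lift}
    (partitions-unique m) (partitions-unique n) lift-injective
    (λ {ρ} ρ∈ → ∈-partitions⁺ m (lift-rgs ρ (∈-partitions⁻ n ρ∈)) , σ≤lift ρ)
    (λ {π} π∈ σ≤π →
      collapse π , ∈-partitions⁺ n (collapse-rgs π (∈-partitions⁻ m π∈) σ≤π) , lift-collapse π σ≤π)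
    f≡0

  mobF-lift : ∀ f ρ τ → mobF m f (lift ρ) (lift τ) ≡ mobF n f ρ τ
  mobF-lift zero    ρ τ = refl
  mobF-lift (suc f) ρ τ = unfolding-cong (eqP-lift ρ τ) (leqP-lift ρ τ) (cong -_ (trans (sum-above-σ _ outside)
    (sumℤ-map-cong (partitions n) term≡)))
    where
    unfolding-cong : ∀ {a a' b b' : Bool} {s s' : ℤ} → a ≡ a' → b ≡ b' → s ≡ s' →
      (if a then 1ℤ else if b then s else 0ℤ) ≡ (if a' then 1ℤ else if b' then s' else 0ℤ)
    unfolding-cong refl refl refl = refl
    outside : ∀ π → π ∈ partitions m → leqP σ π ≢ true →
      (if leqP (lift ρ) π ∧ not (leqP π (lift ρ)) ∧ leqP π (lift τ) then mobF m f π (lift τ) else 0ℤ) ≡ 0ℤ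
    outside π _ σ≰π with leqP (lift ρ) π in ρ≤π
    ... | false = refl
    ... | true  = ⊥-elim (σ≰π (leqP-trans σ (lift ρ) π (σ≤lift ρ) ρ≤π))
    term≡ : ∀ ρ' → ρ' ∈ partitions n →
      (if leqP (lift ρ) (lift ρ') ∧ not (leqP (lift ρ') (lift ρ)) ∧ leqP (lift ρ') (lift τ)
         then mobF m f (lift ρ') (lift τ) else 0ℤ) ≡
      (if leqP ρ ρ' ∧ not (leqP ρ' ρ) ∧ leqP ρ' τ then mobF n f ρ' τ else 0ℤ)
    term≡ ρ' _ rewrite leqP-lift ρ ρ' | leqP-lift ρ' ρ | leqP-lift ρ' τ | mobF-lift f ρ' τ = refl

  -- μ runs the recursion with fuel 2n+1 on 𝒫(2n) but n+1 on 𝒫(n); both exceed the number of blocks.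
  μ-lift : ∀ ρ → μ m (lift ρ) (top m) ≡ μ n ρ (top n)
  μ-lift ρ = begin
    mobF m (suc m) (lift ρ) (top m)         ≡⟨ cong (mobF m (suc m) (lift ρ)) lift-top ⟨
    mobF m (suc m) (lift ρ) (lift (top n))  ≡⟨ mobF-lift (suc m) ρ (top n) ⟩
    mobF n (suc m) ρ (top n)                ≡⟨ cong (λ f → mobF n f ρ (top n)) (m∸n+1+n≡1+m) ⟨
    mobF n (m ∸ n + suc n) ρ (top n)        ≡⟨ mobF-+ (m ∸ n) (suc n) ρ (top n) (s≤s (#blocks≤ ρ)) ⟨
    mobF n (suc n) ρ (top n)                ∎
    where
    open ≡-Reasoning
    m∸n+1+n≡1+m : m ∸ n + suc n ≡ suc m
    m∸n+1+n≡1+m = trans (+-suc (m ∸ n) n) (cong suc (m∸n+n≡m (m≤m+n n (n + 0))))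

  point-of-arch : ∀ (z x y : Fin m) → toℕ x < toℕ y → lookup σ z ≡ lookup σ x → lookup σ z ≡ lookup σ y →
    toℕ z ≡ toℕ x ⊎ toℕ z ≡ toℕ y
  point-of-arch z x y x<y σz≡σx σz≡σy with toℕ z ≟ toℕ x | toℕ z ≟ toℕ y
  ... | yes z≡x | _       = inj₁ z≡x
  ... | no _    | yes z≡y = inj₂ z≡y
  ... | no z≢x  | no z≢y  = ⊥-elim (no-three-in-block z x y z≢x z≢y (<⇒≢ x<y) σz≡σx σz≡σy)

  endpoints-unique : ∀ (x y x' y' : Fin m) → toℕ x < toℕ y → toℕ x' < toℕ y' → lookup σ x ≡ lookup σ y →
    lookup σ x ≡ lookup σ x' → lookup σ x ≡ lookup σ y' → x ≡ x' × y ≡ y'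
  endpoints-unique x y x' y' x<y x'<y' σx≡σy σx≡σx' σx≡σy'
    with point-of-arch x x' y' x'<y' σx≡σx' σx≡σy'
       | point-of-arch y x' y' x'<y' (trans (sym σx≡σy) σx≡σx') (trans (sym σx≡σy) σx≡σy')
  ... | inj₁ x≡x' | inj₁ y≡x' = ⊥-elim (<⇒≢ x<y (trans x≡x' (sym y≡x')))
  ... | inj₁ x≡x' | inj₂ y≡y' = toℕ-injective x≡x' , toℕ-injective y≡y'
  ... | inj₂ x≡y' | inj₁ y≡x' = ⊥-elim (<-asym x<y (subst₂ _<_ (sym y≡x') (sym x≡y') x'<y'))
  ... | inj₂ x≡y' | inj₂ y≡y' = ⊥-elim (<⇒≢ x<y (trans x≡y' (sym y≡y')))

  crossesVia-unique : ∀ a b {q q'} → crossesVia σ a b q ≡ true → crossesVia σ a b q' ≡ true → q ≡ q'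
  crossesVia-unique a b {i , k , j , l} {i' , k' , j' , l'} cv cv'
    with ord , σi , σj , σk , σl ← crossesVia-true⁻ σ a b i k j l cv
    with ord' , σi' , σj' , σk' , σl' ← crossesVia-true⁻ σ a b i' k' j' l' cv'
    with i<k , k<j , j<l ← ordered-true⁻ i k j l ord
    with i<k' , k<j' , j<l' ← ordered-true⁻ i' k' j' l' ord'
    with refl , refl ← endpoints-unique i j i' j' (<-trans i<k k<j) (<-trans i<k' k<j')
                         (trans σi (sym σj)) (trans σi (sym σi')) (trans σi (sym σj'))
    with refl , refl ← endpoints-unique k l k' l' (<-trans k<j j<l) (<-trans k<j' j<l')
                         (trans σk (sym σl)) (trans σk (sym σk')) (trans σk (sym σl'))
    = refl

  -- Otherwise the left endpoints of the two arches would each precede the other.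
  crossesVia-asym : ∀ a b {q q'} → crossesVia σ a b q ≡ true → crossesVia σ b a q' ≡ true → ⊥
  crossesVia-asym a b {i , k , j , l} {i' , k' , j' , l'} cv cv'
    with ord , σi , σj , σk , σl ← crossesVia-true⁻ σ a b i k j l cv
    with ord' , σi' , σj' , σk' , σl' ← crossesVia-true⁻ σ b a i' k' j' l' cv'
    with i<k , k<j , j<l ← ordered-true⁻ i k j l ord
    with i<k' , k<j' , j<l' ← ordered-true⁻ i' k' j' l' ord'
    with refl , refl ← endpoints-unique i j k' l' (<-trans i<k k<j) (<-trans k<j' j<l')
                         (trans σi (sym σj)) (trans σi (sym σk')) (trans σi (sym σl'))
    with refl , refl ← endpoints-unique k l i' j' (<-trans k<j j<l) (<-trans i<k' k<j')
                         (trans σk (sym σl)) (trans σk (sym σi')) (trans σk (sym σj'))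
    = <-asym i<k i<k'

  edgeVia : Fin n → Fin n → Quad m → Bool
  edgeVia a b q = crossesVia σ (toℕ a) (toℕ b) q ∨ crossesVia σ (toℕ b) (toℕ a) q

  edgeVia-unique : ∀ a b {q q'} → edgeVia a b q ≡ true → edgeVia a b q' ≡ true → q ≡ q'
  edgeVia-unique a b {q} {q'} e e' with ∨-true⁻ {crossesVia σ (toℕ a) (toℕ b) q} e
                                      | ∨-true⁻ {crossesVia σ (toℕ a) (toℕ b) q'} e'
  ... | inj₁ ab | inj₁ ab' = crossesVia-unique (toℕ a) (toℕ b) {q} {q'} ab ab'
  ... | inj₂ ba | inj₂ ba' = crossesVia-unique (toℕ b) (toℕ a) {q} {q'} ba ba'
  ... | inj₁ ab | inj₂ ba' = ⊥-elim (crossesVia-asym (toℕ a) (toℕ b) {q} {q'} ab ba')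
  ... | inj₂ ba | inj₁ ab' = ⊥-elim (crossesVia-asym (toℕ b) (toℕ a) {q} {q'} ba ab')

  -- The arches (a , b), a < b, through the first two points of a quadruple.
  archPair : Quad m → Fin n × Fin n → Bool
  archPair (i , k , j , l) (a , b) = (toℕ a <ᵇ toℕ b) ∧
    (((lookup σ i ≡ᵇ toℕ a) ∧ (lookup σ k ≡ᵇ toℕ b)) ∨ ((lookup σ i ≡ᵇ toℕ b) ∧ (lookup σ k ≡ᵇ toℕ a)))

  archPair-true⁻ : ∀ (i k j l : Fin m) a b → archPair (i , k , j , l) (a , b) ≡ true → toℕ a < toℕ b ×
    ((lookup σ i ≡ toℕ a × lookup σ k ≡ toℕ b) ⊎ (lookup σ i ≡ toℕ b × lookup σ k ≡ toℕ a))
  archPair-true⁻ i k j l a b ap with a<b , ends ← ∧-true⁻ ap with ∨-true⁻ ends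
  ... | inj₁ ab with σi , σk ← ∧-true⁻ ab = <ᵇ-true⁻ _ _ a<b , inj₁ (≡ᵇ-true⁻ _ _ σi , ≡ᵇ-true⁻ _ _ σk)
  ... | inj₂ ba with σi , σk ← ∧-true⁻ ba = <ᵇ-true⁻ _ _ a<b , inj₂ (≡ᵇ-true⁻ _ _ σi , ≡ᵇ-true⁻ _ _ σk)

  archPair-unique : ∀ q {p p'} → archPair q p ≡ true → archPair q p' ≡ true → p ≡ p'
  archPair-unique (i , k , j , l) {a , b} {a' , b'} ap ap'
    with archPair-true⁻ i k j l a b ap | archPair-true⁻ i k j l a' b' ap'
  ... | _   , inj₁ (σi , σk) | _    , inj₁ (σi' , σk') =
    cong₂ _,_ (toℕ-injective (trans (sym σi) σi')) (toℕ-injective (trans (sym σk) σk'))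
  ... | _   , inj₂ (σi , σk) | _    , inj₂ (σi' , σk') =
    cong₂ _,_ (toℕ-injective (trans (sym σk) σk')) (toℕ-injective (trans (sym σi) σi'))
  ... | a<b , inj₁ (σi , σk) | a'<b' , inj₂ (σi' , σk') =
    ⊥-elim (<-asym a<b (subst₂ _<_ (trans (sym σk') σk) (trans (sym σi') σi) a'<b'))
  ... | a<b , inj₂ (σi , σk) | a'<b' , inj₁ (σi' , σk') =
    ⊥-elim (<-asym a<b (subst₂ _<_ (trans (sym σi') σi) (trans (sym σk') σk) a'<b'))

  archPair-exists : ∀ (i k j l : Fin m) → lookup σ i ≢ lookup σ k → ∃[ p ] archPair (i , k , j , l) p ≡ true
  archPair-exists i k j l σi≢σk with <-cmp (lookup σ i) (lookup σ k)
  ... | tri< σi<σk _ _ = (arch i , arch k) ,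
    ∧-true⁺ (<ᵇ-true⁺ (subst₂ _<_ (sym (toℕ-arch i)) (sym (toℕ-arch k)) σi<σk))
            (∨-trueˡ _ (∧-true⁺ (≡ᵇ-true⁺ _ _ (sym (toℕ-arch i))) (≡ᵇ-true⁺ _ _ (sym (toℕ-arch k)))))
  ... | tri≈ _ σi≡σk _ = ⊥-elim (σi≢σk σi≡σk)
  ... | tri> _ _ σk<σi = (arch k , arch i) ,
    ∧-true⁺ (<ᵇ-true⁺ (subst₂ _<_ (sym (toℕ-arch k)) (sym (toℕ-arch i)) σk<σi))
            (∨-trueʳ _ (∧-true⁺ (≡ᵇ-true⁺ _ _ (sym (toℕ-arch i))) (≡ᵇ-true⁺ _ _ (sym (toℕ-arch k)))))

  crossing-archPairs : ∀ π q → indicator (crossingIn σ π q) ≡ countL (pairs n) (λ p → crossingIn σ π q ∧ archPair q p)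
  crossing-archPairs π q@(i , k , j , l) with crossingIn σ π q in c
  ... | false = sym (countL-zero (pairs n) _ (λ _ _ → refl))
  ... | true
    with ord , σi≡σj , _ ← crossingIn-true⁻ σ π i k j l c
    with i<k , k<j , _ ← ordered-true⁻ i k j l ord
    with (a , b) , ap ← archPair-exists i k j l
           (no-three-in-block i j k (<⇒≢ (<-trans i<k k<j)) (<⇒≢ i<k) (<⇒≢ k<j ∘ sym) σi≡σj)
    = sym (countL-single (pairs n) (archPair q) (pairs-unique n) (archPair-unique q) (∈-pairs a b) ap)

  crossing⇒edgeVia : ∀ π a b q → (crossingIn σ π q ∧ archPair q (a , b)) ≡ true → edgeVia a b q ≡ true
  crossing⇒edgeVia π a b q@(i , k , j , l) c∧ap
    with c , ap ← ∧-true⁻ c∧ap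
    with ord , σi≡σj , σk≡σl , _ ← crossingIn-true⁻ σ π i k j l c
    with archPair-true⁻ i k j l a b ap
  ... | _ , inj₁ (σi , σk) =
    ∨-trueˡ _ (crossesVia-true⁺ σ i k j l ord σi (trans (sym σi≡σj) σi) σk (trans (sym σk≡σl) σk))
  ... | _ , inj₂ (σi , σk) =
    ∨-trueʳ _ (crossesVia-true⁺ σ i k j l ord σi (trans (sym σi≡σj) σi) σk (trans (sym σk≡σl) σk))

  module _ (ρ : Partition n) where

    same-lift-arches : ∀ i k {a b : Fin n} → lookup σ i ≡ toℕ a → lookup σ k ≡ toℕ b →
      same (lift ρ) i k ≡ same ρ a b
    same-lift-arches i k {a} {b} σi σk = trans (same-lift ρ i k) (cong₂ (same ρ) (arch-≡ i a σi) (arch-≡ k b σk))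

    crossingIn-lift-true⁺ : ∀ (i k j l : Fin m) {a b : Fin n} → ordered (i , k , j , l) ≡ true →
      lookup σ i ≡ toℕ a → lookup σ j ≡ toℕ a → lookup σ k ≡ toℕ b → lookup σ l ≡ toℕ b → same ρ a b ≡ true →
      crossingIn σ (lift ρ) (i , k , j , l) ≡ true
    crossingIn-lift-true⁺ i k j l {a} ord σi σj σk σl ρab =
      ∧-true⁺ ord (∧-true⁺ (same-true⁺ σ i j (trans σi (sym σj))) (∧-true⁺ (same-true⁺ σ k l (trans σk (sym σl)))
        (∧-true⁺ (trans (same-lift-arches i k σi σk) ρab)
          (∧-true⁺ (trans (same-lift-arches i j σi σj) (≡ᵇ-refl (lookup ρ a))) (trans (same-lift-arches i l σi σl) ρab)))))

    edgeVia⇒crossing : ∀ a b q → (toℕ a <ᵇ toℕ b) ≡ true → same ρ a b ≡ true → edgeVia a b q ≡ true →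
      (crossingIn σ (lift ρ) q ∧ archPair q (a , b)) ≡ true
    edgeVia⇒crossing a b q@(i , k , j , l) a<b ρab ev with ∨-true⁻ {crossesVia σ (toℕ a) (toℕ b) q} ev
    ... | inj₁ ab with ord , σi , σj , σk , σl ← crossesVia-true⁻ σ _ _ i k j l ab =
      ∧-true⁺ (crossingIn-lift-true⁺ i k j l ord σi σj σk σl ρab)
              (∧-true⁺ a<b (∨-trueˡ _ (∧-true⁺ (≡ᵇ-true⁺ _ _ σi) (≡ᵇ-true⁺ _ _ σk))))
    ... | inj₂ ba with ord , σi , σj , σk , σl ← crossesVia-true⁻ σ _ _ i k j l ba =
      ∧-true⁺ (crossingIn-lift-true⁺ i k j l ord σi σj σk σl (trans (≡ᵇ-sym (lookup ρ b) (lookup ρ a)) ρab))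
              (∧-true⁺ a<b (∨-trueʳ _ (∧-true⁺ (≡ᵇ-true⁺ _ _ σi) (≡ᵇ-true⁺ _ _ σk))))

    crossings-unordered : ∀ a b → (toℕ a <ᵇ toℕ b) ≡ false →
      countL (quads m) (λ q → crossingIn σ (lift ρ) q ∧ archPair q (a , b)) ≡ 0
    crossings-unordered a b a≮b = countL-zero (quads m) _ λ q _ → ¬-not λ c∧ap →
      false≢true (trans (sym a≮b) (proj₁ (∧-true⁻ (proj₂ (∧-true⁻ {crossingIn σ (lift ρ) q} c∧ap)))))

    crossings-separated : ∀ a b → same ρ a b ≡ false →
      countL (quads m) (λ q → crossingIn σ (lift ρ) q ∧ archPair q (a , b)) ≡ 0
    crossings-separated a b ρa≢ρb = countL-zero (quads m) _ λ q _ → ¬-not (separated q)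
      where
      separated : ∀ q → (crossingIn σ (lift ρ) q ∧ archPair q (a , b)) ≢ true
      separated (i , k , j , l) c∧ap
        with c , ap ← ∧-true⁻ c∧ap
        with _ , _ , _ , πik ← crossingIn-true⁻ σ (lift ρ) i k j l c
        with archPair-true⁻ i k j l a b ap
      ... | _ , inj₁ (σi , σk) = false≢true (trans (sym ρa≢ρb) (trans (sym (same-lift-arches i k σi σk)) πik))
      ... | _ , inj₂ (σi , σk) = false≢true (trans (sym ρa≢ρb)
              (trans (≡ᵇ-sym (lookup ρ a) (lookup ρ b)) (trans (sym (same-lift-arches i k σi σk)) πik)))

    crossings-edge : ∀ a b → (toℕ a <ᵇ toℕ b) ≡ true → same ρ a b ≡ true →
      countL (quads m) (λ q → crossingIn σ (lift ρ) q ∧ archPair q (a , b)) ≡ indicator (edge σ a b)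
    crossings-edge a b a<b ρab = begin
      countL (quads m) (λ q → crossingIn σ (lift ρ) q ∧ archPair q (a , b))
        ≡⟨ countL-cong (quads m) (λ q _ →
             true⇔⇒≡ (crossing⇒edgeVia (lift ρ) a b q) (edgeVia⇒crossing a b q a<b ρab)) ⟩
      countL (quads m) (edgeVia a b)
        ≡⟨ countL-atMostOne (quads m) (edgeVia a b) (quads-unique m) (edgeVia-unique a b) ⟩
      indicator (anyL (quads m) (edgeVia a b))
        ≡⟨ cong indicator (anyL-∨ (quads m) _ _) ⟩
      indicator (edge σ a b)
        ∎
      where open ≡-Reasoning

    pair-crossings : ∀ a b → countL (quads m) (λ q → crossingIn σ (lift ρ) q ∧ archPair q (a , b)) ≡
      indicator ((toℕ a <ᵇ toℕ b) ∧ edge σ a b ∧ same ρ a b)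
    pair-crossings a b = indicator-∧-cases (toℕ a <ᵇ toℕ b) (edge σ a b) (same ρ a b)
      (crossings-unordered a b) (crossings-separated a b) (crossings-edge a b)

    -- Double counting: every crossing quadruple is attributed to the unique pair of its two arches.
    cro-lift : cro σ (lift ρ) ≡ iE σ ρ
    cro-lift = begin
      countL (quads m) (crossingIn σ (lift ρ))
        ≡⟨ countL≡sumL (quads m) _ ⟩
      sumL (quads m) (indicator ∘ crossingIn σ (lift ρ))
        ≡⟨ sumL-cong (quads m) (λ q _ → trans (crossing-archPairs (lift ρ) q) (countL≡sumL (pairs n) _)) ⟩
      sumL (quads m) (λ q → sumL (pairs n) (λ p → indicator (crossingIn σ (lift ρ) q ∧ archPair q p)))
        ≡⟨ sumL-swap (quads m) (pairs n) _ ⟩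
      sumL (pairs n) (λ p → sumL (quads m) (λ q → indicator (crossingIn σ (lift ρ) q ∧ archPair q p)))
        ≡⟨ sumL-cong (pairs n) (λ (a , b) _ → trans (sym (countL≡sumL (quads m) _)) (pair-crossings a b)) ⟩
      sumL (pairs n) (λ (a , b) → indicator ((toℕ a <ᵇ toℕ b) ∧ edge σ a b ∧ same ρ a b))
        ≡⟨ countL≡sumL (pairs n) _ ⟨
      iE σ ρ
        ∎
      where open ≡-Reasoning

lemma3p3 : (n : ℕ) → 1 ≤ n → (σ : Partition (2 * n)) → σ ∈ partitions (2 * n) →
    IsMatching σ → (k : ℕ) → lhsCoeff n σ k ≡ rhsCoeff n σ k
lemma3p3 n n≥1 σ σ∈ σ-matching k = begin
  lhsCoeff n σ k
    ≡⟨ sum-above-σ _ (λ π _ σ≰π → cong (λ b → if b ∧ (cro σ π ≡ᵇ k) then μ m π (top m) else 0ℤ) (¬-not σ≰π)) ⟩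
  sumℤ (map (λ ρ → if leqP σ (lift ρ) ∧ (cro σ (lift ρ) ≡ᵇ k) then μ m (lift ρ) (top m) else 0ℤ) (partitions n))
    ≡⟨ sumℤ-map-cong (partitions n) (λ ρ _ → summand≡ ρ) ⟩
  rhsCoeff n σ k
    ∎
  where
  open Arches n n≥1 σ (∈-partitions⁻ (2 * n) σ∈) σ-matching
  open ≡-Reasoning
  summand≡ : ∀ ρ → (if leqP σ (lift ρ) ∧ (cro σ (lift ρ) ≡ᵇ k) then μ m (lift ρ) (top m) else 0ℤ) ≡
                   (if iE σ ρ ≡ᵇ k then μ n ρ (top n) else 0ℤ)
  summand≡ ρ rewrite σ≤lift ρ | cro-lift ρ | μ-lift ρ = refl
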